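{- Let $\mathcal{A}\subseteq\{\mathsf{N},\mathsf{M},\mathsf{C}\}$. Contraction is admissible in $\mathsf{LNS}_{\mathsf{E}\mathcal{A}}$: if $\mathcal{S}\{\Gamma,A,A\Rightarrow\Delta\}$ (resp. $\mathcal{S}\{\Gamma\Rightarrow\Delta,A,A\}$) is derivable in $\mathsf{LNS}_{\mathsf{E}\mathcal{A}}$, then $\mathcal{S}\{\Gamma,A\Rightarrow\Delta\}$ (resp. $\mathcal{S}\{\Gamma\Rightarrow\Delta,A\}$) is derivable in $\mathsf{LNS}_{\mathsf{E}\mathcal{A}}$.
   Context: Formulas: propositional variables, $\bot,\top,\neg,\land,\lor,\to,\Box$. Structures: $\mathcal{X}::=\Gamma\Rightarrow\Delta\mid\Gamma\Rightarrow\Delta\,/_{\mathsf e}(\Sigma\Rightarrow\Pi;\Omega\Rightarrow\Theta)\mid\Gamma\Rightarrow\Delta\,/\,\mathcal{X}$ with finite multisets of formulas (components); $\mathcal{S}\{\Gamma\Rightarrow\Delta\}$ has a distinguished component, $\mathcal{G}/\Gamma\Rightarrow\Delta$ has last component $\Gamma\Rightarrow\Delta$. $\mathsf{LNS}_{\mathsf{E}\mathcal{A}}$ (no explicit structural rules): propositional rules (zero-premiss $\mathcal{S}\{\Gamma,p\Rightarrow p,\Delta\}$ with $p$ atomic, $\mathcal{S}\{\Gamma,\bot\Rightarrow\Delta\}$, $\mathcal{S}\{\Gamma\Rightarrow\top,\Delta\}$, and the standard two-sided invertible rules for $\neg,\land,\lor,\to$ on one component), not applicable to sequents inside $/_{\mathsf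 e}$; $\Box^{\mathsf e}_R$: $\mathcal{G}/\Gamma\Rightarrow\Delta/_{\mathsf e}(\Rightarrow B;B\Rightarrow)$ / $\mathcal{G}/\Gamma\Rightarrow\Box B,\Delta$; $\Box^{\mathsf e}_L$: $\mathcal{G}/\Gamma\Rightarrow\Delta/\Sigma,A\Rightarrow\Pi$ and $\mathcal{G}/\Gamma\Rightarrow\Delta/\Omega\Rightarrow A,\Theta$ / $\mathcal{G}/\Gamma,\Box A\Rightarrow\Delta/_{\mathsf e}(\Sigma\Rightarrow\Pi;\Omega\Rightarrow\Theta)$; if $\mathsf{N}\in\mathcal{A}$: $\mathcal{G}/\Gamma\Rightarrow\Delta/\Rightarrow B$ / $\mathcal{G}/\Gamma\Rightarrow\Box B,\Delta$; if $\mathsf{M}\in\mathcal{A}$: $\mathcal{G}/_{\mathsf e}(\Sigma\Rightarrow\Pi;\Omega,\bot\Rightarrow\Theta)$ / $\mathcal{G}/_{\mathsf e}(\Sigma\Rightarrow\Pi;\Omega\Rightarrow\Theta)$; if $\mathsf{C}\in\mathcal{A}$: $\mathcal{G}/\Gamma\Rightarrow\Delta/_{\mathsf e}(\Sigma,A\Rightarrow\Pi;\Omega\Rightarrow\Theta)$ and $\mathcal{G}/\Gamma\Rightarrow\Delta/\Omega\Rightarrow A,\Theta$ / $\mathcal{G}/\Gamma,\Box A\Rightarrow\Delta/_{\mathsf e}(\Sigma\Rightarrow\Pi;\Omega\Rightarrow\Theta)$. -}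

module Defs where

open import Data.Nat using (ℕ)
open import Data.Bool using (Bool; true; false)
open import Data.List using (List; []; _∷_)
open import Data.Product using (_×_; _,_)
open import Relation.Binary.PropositionalEquality using (_≡_)
open import Data.List.Relation.Binary.Permutation.Propositional using (_↭_)

infixr 30 _⊃_
infixr 35 _∨̇_
infixr 40 _∧̇_
infix  50 ¬̇_ □_

data Fm : Set where
  var  : ℕ → Fm
  ⊥̇ ⊤̇ : Fm
  ¬̇_   : Fm → Fm
  _∧̇_ _∨̇_ _⊃_ : Fm → Fm → Fm
  □_   : Fm → Fm

-- Sequents Γ ⇒ Δ; finite multisets represented by lists, identified up to
-- permutation via the rule `perm` below.
infix 4 _⇒_
record Seq : Set where
  constructor _⇒_
  field
    ante : List Fm
    succ : List Fm

infixr 3 _/_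
data Str : Set where
  leaf : Seq → Str
  eblk : Seq → Seq → Seq → Str      -- eblk s t u  =  s /e (t ; u)
  _/_  : Seq → Str → Str

infixr 2 _⊳_
_⊳_ : List Seq → Str → Str
[] ⊳ X = X
(s ∷ G) ⊳ X = s / (G ⊳ X)

infix 1 _≈_
data _≈_ : Str → Str → Set where
  leaf≈ : ∀ {Γ Γ' Δ Δ'} → Γ ↭ Γ' → Δ ↭ Δ' → leaf (Γ ⇒ Δ) ≈ leaf (Γ' ⇒ Δ')
  eblk≈ : ∀ {Γ Γ' Δ Δ' Σ Σ' Π Π' Ω Ω' Θ Θ'} →
          Γ ↭ Γ' → Δ ↭ Δ' → Σ ↭ Σ' → Π ↭ Π' → Ω ↭ Ω' → Θ ↭ Θ' →
          eblk (Γ ⇒ Δ) (Σ ⇒ Π) (Ω ⇒ Θ) ≈ eblk (Γ' ⇒ Δ') (Σ' ⇒ Π') (Ω' ⇒ Θ')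
  /≈    : ∀ {Γ Γ' Δ Δ' X X'} → Γ ↭ Γ' → Δ ↭ Δ' → X ≈ X' →
          (Γ ⇒ Δ) / X ≈ (Γ' ⇒ Δ') / X'

-- Contexts S{ } whose hole is a component NOT inside a /e block
-- (these are the contexts of the propositional rules).
data PCtx : Set where
  hole     : PCtx
  holeE    : Seq → Seq → PCtx
  holeS    : Str → PCtx
  consP    : Seq → PCtx → PCtx

pplug : PCtx → Seq → Str
pplug hole         s = leaf s
pplug (holeE t u)  s = eblk s t u
pplug (holeS X)    s = s / X
pplug (consP r S)  s = r / pplug S s

-- General contexts S{ }: the hole may be any component, including the two
-- components inside the final /e block.
data Ctx : Set where
  outer : PCtx → Ctx
  inL   : List Seq → Seq → Seq → Ctx
  inR   : List Seq → Seq → Seq → Ctx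

plug : Ctx → Seq → Str
plug (outer S)   s = pplug S s
plug (inL G r u) s = G ⊳ eblk r s u
plug (inR G r t) s = G ⊳ eblk r t s

record Axioms : Set where
  field
    N M C : Bool
open Axioms public

data Der (𝒜 : Axioms) : Str → Set where
  perm : ∀ {X Y} → X ≈ Y → Der 𝒜 X → Der 𝒜 Y
  init : ∀ S {Γ Δ} (p : ℕ) → Der 𝒜 (pplug S (var p ∷ Γ ⇒ var p ∷ Δ))
  ⊥L   : ∀ S {Γ Δ} → Der 𝒜 (pplug S (⊥̇ ∷ Γ ⇒ Δ))
  ⊤R   : ∀ S {Γ Δ} → Der 𝒜 (pplug S (Γ ⇒ ⊤̇ ∷ Δ))
  ¬L   : ∀ S {Γ Δ A} → Der 𝒜 (pplug S (Γ ⇒ A ∷ Δ)) → Der 𝒜 (pplug S (¬̇ A ∷ Γ ⇒ Δ))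
  ¬R   : ∀ S {Γ Δ A} → Der 𝒜 (pplug S (A ∷ Γ ⇒ Δ)) → Der 𝒜 (pplug S (Γ ⇒ ¬̇ A ∷ Δ))
  ∧L   : ∀ S {Γ Δ A B} → Der 𝒜 (pplug S (A ∷ B ∷ Γ ⇒ Δ)) → Der 𝒜 (pplug S (A ∧̇ B ∷ Γ ⇒ Δ))
  ∧R   : ∀ S {Γ Δ A B} → Der 𝒜 (pplug S (Γ ⇒ A ∷ Δ)) → Der 𝒜 (pplug S (Γ ⇒ B ∷ Δ)) →
         Der 𝒜 (pplug S (Γ ⇒ A ∧̇ B ∷ Δ))
  ∨L   : ∀ S {Γ Δ A B} → Der 𝒜 (pplug S (A ∷ Γ ⇒ Δ)) → Der 𝒜 (pplug S (B ∷ Γ ⇒ Δ)) →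
         Der 𝒜 (pplug S (A ∨̇ B ∷ Γ ⇒ Δ))
  ∨R   : ∀ S {Γ Δ A B} → Der 𝒜 (pplug S (Γ ⇒ A ∷ B ∷ Δ)) → Der 𝒜 (pplug S (Γ ⇒ A ∨̇ B ∷ Δ))
  ⊃L   : ∀ S {Γ Δ A B} → Der 𝒜 (pplug S (Γ ⇒ A ∷ Δ)) → Der 𝒜 (pplug S (B ∷ Γ ⇒ Δ)) →
         Der 𝒜 (pplug S (A ⊃ B ∷ Γ ⇒ Δ))
  ⊃R   : ∀ S {Γ Δ A B} → Der 𝒜 (pplug S (A ∷ Γ ⇒ B ∷ Δ)) → Der 𝒜 (pplug S (Γ ⇒ A ⊃ B ∷ Δ))
  □eR  : ∀ G {Γ Δ B} →
         Der 𝒜 (G ⊳ eblk (Γ ⇒ Δ) ([] ⇒ B ∷ []) (B ∷ [] ⇒ [])) →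
         Der 𝒜 (G ⊳ leaf (Γ ⇒ □ B ∷ Δ))
  □eL  : ∀ G {Γ Δ Σ Π Ω Θ A} →
         Der 𝒜 (G ⊳ (Γ ⇒ Δ) / leaf (A ∷ Σ ⇒ Π)) →
         Der 𝒜 (G ⊳ (Γ ⇒ Δ) / leaf (Ω ⇒ A ∷ Θ)) →
         Der 𝒜 (G ⊳ eblk (□ A ∷ Γ ⇒ Δ) (Σ ⇒ Π) (Ω ⇒ Θ))
  Nrule : ∀ G {Γ Δ B} → N 𝒜 ≡ true →
         Der 𝒜 (G ⊳ (Γ ⇒ Δ) / leaf ([] ⇒ B ∷ [])) →
         Der 𝒜 (G ⊳ leaf (Γ ⇒ □ B ∷ Δ))
  Mrule : ∀ G {s Σ Π Ω Θ} → M 𝒜 ≡ true →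
         Der 𝒜 (G ⊳ eblk s (Σ ⇒ Π) (⊥̇ ∷ Ω ⇒ Θ)) →
         Der 𝒜 (G ⊳ eblk s (Σ ⇒ Π) (Ω ⇒ Θ))
  Crule : ∀ G {Γ Δ Σ Π Ω Θ A} → C 𝒜 ≡ true →
         Der 𝒜 (G ⊳ eblk (Γ ⇒ Δ) (A ∷ Σ ⇒ Π) (Ω ⇒ Θ)) →
         Der 𝒜 (G ⊳ (Γ ⇒ Δ) / leaf (Ω ⇒ A ∷ Θ)) →
         Der 𝒜 (G ⊳ eblk (□ A ∷ Γ ⇒ Δ) (Σ ⇒ Π) (Ω ⇒ Θ))

-- The proof works in an equivalent presentation of LNS_{E𝒜}: a nested sequent is a
-- vector of components indexed from the last one (where all modal rules act), and the
-- permutation rule is absorbed into the rules, which locate principal formulas only up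
-- to permutation.  Weakening and the invertibility of the propositional rules are then
-- admissible, and contraction of A, A is proved by induction on A and on the derivation.
-- If neither copy is principal, contraction moves into the premisses.  If one copy is
-- principal in a propositional rule, the other copy is inverted in the premisses and the
-- duplicated subformulas are contracted by the induction hypothesis on A.  If one copy
-- □B is principal in a modal rule, the other copy becomes inert in the premisses (it no
-- longer sits in the last component, or sits on the right before an e-block) and is
-- deleted; the one exception is the left premiss of the C-rule, where one more
-- C-inference on the remaining □B absorbs the surplus B.

module Submission where

open import Defs
open import Data.Bool using (true)
open import Data.Empty using (⊥; ⊥-elim)
open import Data.Fin using (Fin; zero; suc; _≟_)
open import Data.List using (List; []; _∷_; _++_; map)
open import Data.List.Membership.Propositional using (_∈_)
open import Data.List.Membership.Propositional.Properties using (∈-++⁺ʳ; ∈-∃++; ∈-map⁺)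
open import Data.List.Relation.Unary.Any using (here; there)
open import Data.List.Relation.Binary.Permutation.Propositional
  using (_↭_; ↭-refl; ↭-sym; ↭-trans; ↭-prep; ↭-swap)
open import Data.List.Relation.Binary.Permutation.Propositional.Properties
  using (∈-resp-↭; shift; drop-∷; ++⁺ˡ; shifts)
open import Data.List.Properties using (++-assoc)
open import Data.Maybe using (Maybe; just; nothing)
open import Data.Maybe.Relation.Binary.Pointwise as Maybe using (just; nothing)
open import Data.Nat using (ℕ; zero; suc)
open import Data.Product using (_×_; _,_; ∃; proj₁; proj₂)
open import Data.Sum using (_⊎_; inj₁; inj₂)
open import Data.Vec.Functional using (Vector; tail; updateAt) renaming (_∷_ to _◂_)
open import Data.Vec.Functional.Relation.Binary.Pointwise using (Pointwise)
import Data.Product.Relation.Binary.Pointwise.NonDependent as ×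
open import Data.Vec.Functional.Properties
  using (updateAt-updates; updateAt-minimal; updateAt-commutes; updateAt-updateAt; updateAt-id-local)
open import Function using (const; _∘_)
open import Relation.Nullary using (¬_; yes; no)
open import Relation.Binary.PropositionalEquality
  using (_≡_; _≢_; _≗_; refl; sym; trans; cong; cong₂; subst)

-- Sequents up to permutation

open Seq

infix 4 _≈ₛ_
_≈ₛ_ : Seq → Seq → Set
s ≈ₛ s′ = ante s ↭ ante s′ × succ s ↭ succ s′

≈ₛ-refl : ∀ {s} → s ≈ₛ s
≈ₛ-refl = ↭-refl , ↭-refl

≈ₛ-sym : ∀ {s s′} → s ≈ₛ s′ → s′ ≈ₛ s
≈ₛ-sym (p , q) = ↭-sym p , ↭-sym q

≈ₛ-trans : ∀ {s s′ s″} → s ≈ₛ s′ → s′ ≈ₛ s″ → s ≈ₛ s″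
≈ₛ-trans (p , q) (p′ , q′) = ↭-trans p p′ , ↭-trans q q′

infixr 5 _⊎ₛ_
_⊎ₛ_ : Seq → Seq → Seq
q ⊎ₛ s = ante q ++ ante s ⇒ succ q ++ succ s

⊎ₛ-congʳ : ∀ q {s s′} → s ≈ₛ s′ → q ⊎ₛ s ≈ₛ q ⊎ₛ s′
⊎ₛ-congʳ q (p , p′) = ++⁺ˡ (ante q) p , ++⁺ˡ (succ q) p′

⊎ₛ-swap : ∀ q q′ s → q ⊎ₛ q′ ⊎ₛ s ≈ₛ q′ ⊎ₛ q ⊎ₛ s
⊎ₛ-swap q q′ s = shifts (ante q) (ante q′) , shifts (succ q) (succ q′)

data Side : Set where
  L R : Side

single : Side → Fm → Seq
single L φ = φ ∷ [] ⇒ []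
single R φ = [] ⇒ φ ∷ []

ins : Side → Fm → Seq → Seq
ins s φ X = single s φ ⊎ₛ X

⊎ₛ-ins : ∀ q s φ {X Z} → X ≈ₛ ins s φ Z → q ⊎ₛ X ≈ₛ ins s φ (q ⊎ₛ Z)
⊎ₛ-ins q s φ {Z = Z} e = ≈ₛ-trans (⊎ₛ-congʳ q e) (⊎ₛ-swap q (single s φ) Z)

⊎ₛ-ins² : ∀ q s A {t X} → t ≈ₛ ins s A (ins s A X) → q ⊎ₛ t ≈ₛ ins s A (ins s A (q ⊎ₛ X))
⊎ₛ-ins² q s A e = ≈ₛ-trans (⊎ₛ-ins q s A e) (⊎ₛ-congʳ (single s A) (⊎ₛ-ins q s A ≈ₛ-refl))

∷-↭-∷-cases : ∀ {x y : Fm} {xs ys} → x ∷ xs ↭ y ∷ ys →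
  (x ≡ y × xs ↭ ys) ⊎ ∃ λ zs → ys ↭ x ∷ zs × xs ↭ y ∷ zs
∷-↭-∷-cases {x} {y} p with ∈-resp-↭ p (here refl)
... | here refl = inj₁ (refl , drop-∷ p)
... | there x∈ys with ∈-∃++ x∈ys
...   | as , bs , refl = inj₂ (as ++ bs , shift x as bs ,
          drop-∷ (↭-trans p (↭-trans (↭-prep y (shift x as bs)) (↭-swap y x ↭-refl))))

ins-cases : ∀ {t} s φ X s′ ψ Y → t ≈ₛ ins s φ X → t ≈ₛ ins s′ ψ Y →
  (s ≡ s′ × φ ≡ ψ × X ≈ₛ Y) ⊎ ∃ λ Z → Y ≈ₛ ins s φ Z × X ≈ₛ ins s′ ψ Z
ins-cases s φ X s′ ψ Y e e′ = go s s′ (≈ₛ-trans (≈ₛ-sym e) e′)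
  where
  go : ∀ s s′ → ins s φ X ≈ₛ ins s′ ψ Y →
       (s ≡ s′ × φ ≡ ψ × X ≈ₛ Y) ⊎ ∃ λ Z → Y ≈ₛ ins s φ Z × X ≈ₛ ins s′ ψ Z
  go L L (p , q) with ∷-↭-∷-cases p
  ... | inj₁ (refl , r) = inj₁ (refl , refl , r , q)
  ... | inj₂ (zs , r , r′) = inj₂ ((zs ⇒ succ Y) , (r , ↭-refl) , (r′ , q))
  go L R (p , q) = inj₂ ((ante X ⇒ succ Y) , (↭-sym p , ↭-refl) , (↭-refl , q))
  go R L (p , q) = inj₂ ((ante Y ⇒ succ X) , (↭-refl , ↭-sym q) , (p , ↭-refl))
  go R R (p , q) with ∷-↭-∷-cases q
  ... | inj₁ (refl , r) = inj₁ (refl , refl , p , r)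
  ... | inj₂ (zs , r , r′) = inj₂ ((ante Y ⇒ zs) , (↭-refl , r) , (p , r′))

ins²-cases : ∀ {t} s A X s′ ψ Y → t ≈ₛ ins s A (ins s A X) → t ≈ₛ ins s′ ψ Y →
  (s ≡ s′ × A ≡ ψ × Y ≈ₛ ins s A X) ⊎ ∃ λ Z → Y ≈ₛ ins s A (ins s A Z) × X ≈ₛ ins s′ ψ Z
ins²-cases s A X s′ ψ Y e e′ with ins-cases s A (ins s A X) s′ ψ Y e e′
... | inj₁ (r , r′ , r″) = inj₁ (r , r′ , ≈ₛ-sym r″)
... | inj₂ (Z₁ , e₁ , e₂) with ins-cases s A X s′ ψ Z₁ ≈ₛ-refl e₂
...   | inj₁ (refl , refl , r) = inj₁ (refl , refl , ≈ₛ-trans e₁ (⊎ₛ-congʳ (single s A) (≈ₛ-sym r)))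
...   | inj₂ (Z , f₁ , f₂) = inj₂ (Z , ≈ₛ-trans e₁ (⊎ₛ-congʳ (single s A) f₁) , f₂)

infix 4 _⊑_
_⊑_ : Seq → Seq → Set
s ⊑ s′ = ∃ λ q → s′ ≈ₛ q ⊎ₛ s

≈⇒⊑ : ∀ {s s′} → s ≈ₛ s′ → s ⊑ s′
≈⇒⊑ e = ([] ⇒ []) , ≈ₛ-sym e

⊑-refl : ∀ {s} → s ⊑ s
⊑-refl = ≈⇒⊑ ≈ₛ-refl

⊑-⊎ₛ : ∀ q {s} → s ⊑ q ⊎ₛ s
⊑-⊎ₛ q = q , ≈ₛ-refl

⊎ₛ-mono-⊑ : ∀ q {s s′} → s ⊑ s′ → q ⊎ₛ s ⊑ q ⊎ₛ s′
⊎ₛ-mono-⊑ q {s} (q′ , e) = q′ , ≈ₛ-trans (⊎ₛ-congʳ q e) (⊎ₛ-swap q q′ s)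

⊑-ins : ∀ {t t′} s φ {Y} → t ≈ₛ ins s φ Y → t ⊑ t′ → ∃ λ Y′ → t′ ≈ₛ ins s φ Y′ × Y ⊑ Y′
⊑-ins s φ {Y} e (q , e′) =
  q ⊎ₛ Y , ≈ₛ-trans e′ (⊎ₛ-ins q s φ e) , ⊑-⊎ₛ q

-- G₁ / … / Gₖ / H, possibly followed by an e-block, is stored as the vector
-- H ◂ Gₖ ◂ … ◂ G₁: the last component, the only one modal rules act on, has index zero.
Comps : ℕ → Set
Comps = Vector Seq

infixl 4 _[_]≔_
_[_]≔_ : ∀ {n} → Comps n → Fin n → Seq → Comps n
f [ i ]≔ c = updateAt f i (const c)

infix 3 _≈ᶜ_ _⊑ᶜ_
_≈ᶜ_ _⊑ᶜ_ : ∀ {n} → Comps n → Comps n → Set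
_≈ᶜ_ = Pointwise _≈ₛ_
_⊑ᶜ_ = Pointwise _⊑_

≈ᶜ-refl : ∀ {n} {f : Comps n} → f ≈ᶜ f
≈ᶜ-refl i = ≈ₛ-refl

≈ᶜ-trans : ∀ {n} {f g h : Comps n} → f ≈ᶜ g → g ≈ᶜ h → f ≈ᶜ h
≈ᶜ-trans p q i = ≈ₛ-trans (p i) (q i)

≗⇒≈ᶜ : ∀ {n} {f g : Comps n} → f ≗ g → f ≈ᶜ g
≗⇒≈ᶜ p i = subst (_ ≈ₛ_) (p i) ≈ₛ-refl

⊑ᶜ-refl : ∀ {n} {f : Comps n} → f ⊑ᶜ f
⊑ᶜ-refl i = ⊑-refl

≈ᶜ⇒⊑ᶜ : ∀ {n} {f g : Comps n} → f ≈ᶜ g → f ⊑ᶜ g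
≈ᶜ⇒⊑ᶜ p i = ≈⇒⊑ (p i)

module _ (R : Seq → Seq → Set) where

  ◂⁺ : ∀ {n} {x y} {f g : Comps n} → R x y → Pointwise R f g → Pointwise R (x ◂ f) (y ◂ g)
  ◂⁺ r rs zero = r
  ◂⁺ r rs (suc i) = rs i

  ≔⁺ : ∀ {n} {f g : Comps n} i {c c′} → Pointwise R f g → R c c′ → Pointwise R (f [ i ]≔ c) (g [ i ]≔ c′)
  ≔⁺ zero rs r zero = r
  ≔⁺ zero rs r (suc j) = rs (suc j)
  ≔⁺ (suc i) rs r zero = rs zero
  ≔⁺ (suc i) rs r (suc j) = ≔⁺ i (rs ∘ suc) r j

◂-mono : ∀ {n} {x y} {f g : Comps n} → x ⊑ y → f ⊑ᶜ g → x ◂ f ⊑ᶜ y ◂ g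
◂-mono = ◂⁺ _⊑_

≔-mono : ∀ {n} {f g : Comps n} i {c c′} → f ⊑ᶜ g → c ⊑ c′ → f [ i ]≔ c ⊑ᶜ g [ i ]≔ c′
≔-mono = ≔⁺ _⊑_

◂-cong : ∀ {n} {x y} {f g : Comps n} → x ≈ₛ y → f ≈ᶜ g → x ◂ f ≈ᶜ y ◂ g
◂-cong = ◂⁺ _≈ₛ_

≔-cong : ∀ {n} (f : Comps n) i {c c′} → c ≈ₛ c′ → f [ i ]≔ c ≈ᶜ f [ i ]≔ c′
≔-cong f i = ≔⁺ _≈ₛ_ i ≈ᶜ-refl

◂-≔-zero : ∀ {n x c} {f : Comps n} → (x ◂ f [ zero ]≔ c) ≗ (c ◂ f)
◂-≔-zero zero = refl
◂-≔-zero (suc j) = refl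

◂-≔-suc : ∀ {n x c j} {f : Comps n} → (x ◂ f [ suc j ]≔ c) ≗ (x ◂ (f [ j ]≔ c))
◂-≔-suc zero = refl
◂-≔-suc (suc k) = refl

≔-zero : ∀ {n c} {f : Comps (suc n)} → (c ◂ tail f) ≗ (f [ zero ]≔ c)
≔-zero zero = refl
≔-zero (suc j) = refl

◂◂-≔-one : ∀ {n x y c} {f : Comps n} → (x ◂ y ◂ f [ suc zero ]≔ c) ≗ (x ◂ c ◂ f)
◂◂-≔-one zero = refl
◂◂-≔-one (suc zero) = refl
◂◂-≔-one (suc (suc k)) = refl

◂◂-≔-suc² : ∀ {n x y c j} {f : Comps n} → (x ◂ y ◂ f [ suc (suc j) ]≔ c) ≗ (x ◂ y ◂ (f [ j ]≔ c))
◂◂-≔-suc² zero = refl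
◂◂-≔-suc² (suc zero) = refl
◂◂-≔-suc² (suc (suc k)) = refl

≔-updates : ∀ {n} (f : Comps n) i c → (f [ i ]≔ c) i ≈ₛ c
≔-updates f i c = subst (_≈ₛ c) (sym (updateAt-updates i f)) ≈ₛ-refl

≔-minimal : ∀ {n} (f : Comps n) j c i → i ≢ j → (f [ j ]≔ c) i ≈ₛ f i
≔-minimal f j c i i≢j = subst (_≈ₛ f i) (sym (updateAt-minimal i j f i≢j)) ≈ₛ-refl

≔-elim : ∀ {n} (P : Seq → Set) (f : Comps n) j c i →
         (i ≡ j → P c) → (i ≢ j → P (f i)) → P ((f [ j ]≔ c) i)
≔-elim P f j c i p p′ with i ≟ j
... | yes refl = subst P (sym (updateAt-updates i f)) (p refl)
... | no i≢j = subst P (sym (updateAt-minimal i j f i≢j)) (p′ i≢j)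

≔-comm : ∀ {n} (f : Comps n) {i j} c c′ → j ≢ i → f [ i ]≔ c [ j ]≔ c′ ≈ᶜ f [ j ]≔ c′ [ i ]≔ c
≔-comm f c c′ j≢i = ≗⇒≈ᶜ (updateAt-commutes _ _ j≢i f)

≔²-cong : ∀ {n} (f : Comps n) i {c c′} c₁ → c ≈ₛ c′ → f [ i ]≔ c₁ [ i ]≔ c ≈ᶜ f [ i ]≔ c′
≔²-cong f i c₁ e = ≈ᶜ-trans (≗⇒≈ᶜ (updateAt-updateAt i f)) (≔-cong f i e)

≔²-cong² : ∀ {n} (f : Comps n) i {c c′} c₁ c₁′ → c ≈ₛ c′ →
           f [ i ]≔ c₁ [ i ]≔ c ≈ᶜ f [ i ]≔ c₁′ [ i ]≔ c′
≔²-cong² f i c₁ c₁′ e = ≈ᶜ-trans (≔²-cong f i c₁ e) (λ j → ≈ₛ-sym (≔²-cong f i c₁′ ≈ₛ-refl j))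

-- Each premiss is the conclusion with φ replaced by (the formulas of) one listed sequent.
data PropRule : Side → Fm → List Seq → Set where
  ¬l : ∀ {A} → PropRule L (¬̇ A) (([] ⇒ A ∷ []) ∷ [])
  ¬r : ∀ {A} → PropRule R (¬̇ A) ((A ∷ [] ⇒ []) ∷ [])
  ∧l : ∀ {A B} → PropRule L (A ∧̇ B) ((A ∷ B ∷ [] ⇒ []) ∷ [])
  ∧r : ∀ {A B} → PropRule R (A ∧̇ B) (([] ⇒ A ∷ []) ∷ ([] ⇒ B ∷ []) ∷ [])
  ∨l : ∀ {A B} → PropRule L (A ∨̇ B) ((A ∷ [] ⇒ []) ∷ (B ∷ [] ⇒ []) ∷ [])
  ∨r : ∀ {A B} → PropRule R (A ∨̇ B) (([] ⇒ A ∷ B ∷ []) ∷ [])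
  ⊃l : ∀ {A B} → PropRule L (A ⊃ B) (([] ⇒ A ∷ []) ∷ (B ∷ [] ⇒ []) ∷ [])
  ⊃r : ∀ {A B} → PropRule R (A ⊃ B) ((A ∷ [] ⇒ B ∷ []) ∷ [])

PropRule-unique : ∀ {s φ ps ps′} → PropRule s φ ps → PropRule s φ ps′ → ps ≡ ps′
PropRule-unique ¬l ¬l = refl
PropRule-unique ¬r ¬r = refl
PropRule-unique ∧l ∧l = refl
PropRule-unique ∧r ∧r = refl
PropRule-unique ∨l ∨l = refl
PropRule-unique ∨r ∨r = refl
PropRule-unique ⊃l ⊃l = refl
PropRule-unique ⊃r ⊃r = refl

data Axiom (s : Seq) : Set where
  atom : ∀ p → var p ∈ ante s → var p ∈ succ s → Axiom s
  bot  : ⊥̇ ∈ ante s → Axiom s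
  top  : ⊤̇ ∈ succ s → Axiom s

data Compound : Fm → Set where
  ¬c : ∀ {A} → Compound (¬̇ A)
  ∧c : ∀ {A B} → Compound (A ∧̇ B)
  ∨c : ∀ {A B} → Compound (A ∨̇ B)
  ⊃c : ∀ {A B} → Compound (A ⊃ B)
  □c : ∀ {A} → Compound (□ A)

PropRule-compound : ∀ {s φ ps} → PropRule s φ ps → Compound φ
PropRule-compound ¬l = ¬c
PropRule-compound ¬r = ¬c
PropRule-compound ∧l = ∧c
PropRule-compound ∧r = ∧c
PropRule-compound ∨l = ∨c
PropRule-compound ∨r = ∨c
PropRule-compound ⊃l = ⊃c
PropRule-compound ⊃r = ⊃c

PropRule-□ : ∀ {s A ps} → PropRule s (□ A) ps → ⊥
PropRule-□ ()

Axiom-transfer : ∀ {s s′} →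
  (∀ {x} → ¬ Compound x → x ∈ ante s → x ∈ ante s′) →
  (∀ {x} → ¬ Compound x → x ∈ succ s → x ∈ succ s′) → Axiom s → Axiom s′
Axiom-transfer ha hs (atom p a b) = atom p (ha (λ ()) a) (hs (λ ()) b)
Axiom-transfer ha hs (bot a) = bot (ha (λ ()) a)
Axiom-transfer ha hs (top b) = top (hs (λ ()) b)

Axiom-mono : ∀ {s s′} → Axiom s → s ⊑ s′ → Axiom s′
Axiom-mono a (q , e) = Axiom-transfer (λ _ → ∈-⊎ₛ (ante q) (proj₁ e)) (λ _ → ∈-⊎ₛ (succ q) (proj₂ e)) a
  where
  ∈-⊎ₛ : ∀ {x : Fm} {l l′} q → l′ ↭ q ++ l → x ∈ l → x ∈ l′
  ∈-⊎ₛ q e m = ∈-resp-↭ (↭-sym e) (∈-++⁺ʳ q m)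

∈-remove : ∀ {x φ : Fm} {l l′} → Compound φ → l ↭ φ ∷ l′ → ¬ Compound x → x ∈ l → x ∈ l′
∈-remove c p nc m with ∈-resp-↭ p m
... | here refl = ⊥-elim (nc c)
... | there m′ = m′

∈-contract : ∀ {x A : Fm} {l l′} → l ↭ A ∷ A ∷ l′ → x ∈ l → x ∈ A ∷ l′
∈-contract p m with ∈-resp-↭ p m
... | here e = here e
... | there m′ = m′

Axiom-remove : ∀ s {φ X t} → Compound φ → t ≈ₛ ins s φ X → Axiom t → Axiom X
Axiom-remove L c (p , q) = Axiom-transfer (∈-remove c p) (λ _ → ∈-resp-↭ q)
Axiom-remove R c (p , q) = Axiom-transfer (λ _ → ∈-resp-↭ p) (∈-remove c q)

Axiom-contract : ∀ s {A X t} → t ≈ₛ ins s A (ins s A X) → Axiom t → Axiom (ins s A X)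
Axiom-contract L (p , q) = Axiom-transfer (λ _ → ∈-contract p) (λ _ → ∈-resp-↭ q)
Axiom-contract R (p , q) = Axiom-transfer (λ _ → ∈-resp-↭ p) (λ _ → ∈-contract q)

Block : Set
Block = Maybe (Seq × Seq)

-- LNS with the permutation rule absorbed: principal components are matched up to ≈ₛ.
data IDer (𝒜 : Axioms) : (k : ℕ) → Comps (suc k) → Block → Set where
  ax    : ∀ {k f b} i → Axiom (f i) → IDer 𝒜 k f b
  prop  : ∀ {k f b} i {s φ ps} → PropRule s φ ps → ∀ Y → f i ≈ₛ ins s φ Y →
          (∀ {p} → p ∈ ps → IDer 𝒜 k (f [ i ]≔ p ⊎ₛ Y) b) → IDer 𝒜 k f b
  box-R : ∀ {k f B} Y → f zero ≈ₛ ins R (□ B) Y →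
          IDer 𝒜 k (Y ◂ tail f) (just (([] ⇒ B ∷ []) , (B ∷ [] ⇒ []))) → IDer 𝒜 k f nothing
  box-N : ∀ {k f B} Y → N 𝒜 ≡ true → f zero ≈ₛ ins R (□ B) Y →
          IDer 𝒜 (suc k) (([] ⇒ B ∷ []) ◂ Y ◂ tail f) nothing → IDer 𝒜 k f nothing
  box-L : ∀ {k f A} Y {t u} → f zero ≈ₛ ins L (□ A) Y →
          IDer 𝒜 (suc k) (ins L A t ◂ Y ◂ tail f) nothing →
          IDer 𝒜 (suc k) (ins R A u ◂ Y ◂ tail f) nothing → IDer 𝒜 k f (just (t , u))
  box-M : ∀ {k f t u} → M 𝒜 ≡ true → IDer 𝒜 k f (just (t , ins L ⊥̇ u)) → IDer 𝒜 k f (just (t , u))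
  box-C : ∀ {k f A} Y {t u} → C 𝒜 ≡ true → f zero ≈ₛ ins L (□ A) Y →
          IDer 𝒜 k (Y ◂ tail f) (just (ins L A t , u)) →
          IDer 𝒜 (suc k) (ins R A u ◂ Y ◂ tail f) nothing → IDer 𝒜 k f (just (t , u))

-- A boxed formula is principal only in the last component, and there on the
-- right only if no e-block follows; elsewhere it can simply be deleted.
data Inert {k : ℕ} : Fin (suc k) → Side → Block → Set where
  earlier : ∀ {i s b} → Inert (suc i) s b
  blocked : ∀ {t u} → Inert zero R (just (t , u))

-- Weakening, invertibility and deletion of inert boxed formulas

infix 3 _⊑ᵇ_
_⊑ᵇ_ : Block → Block → Set
_⊑ᵇ_ = Maybe.Pointwise (×.Pointwise _⊑_ _⊑_)

⊑ᵇ-refl : ∀ {b} → b ⊑ᵇ b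
⊑ᵇ-refl {nothing} = nothing
⊑ᵇ-refl {just _} = just (⊑-refl , ⊑-refl)

module _ {𝒜 : Axioms} where

  weaken : ∀ {k f g b b′} → IDer 𝒜 k f b → f ⊑ᶜ g → b ⊑ᵇ b′ → IDer 𝒜 k g b′
  weaken (ax i a) w wb = ax i (Axiom-mono a (w i))
  weaken (prop i {s} {φ} pr Y e ps) w wb with ⊑-ins s φ e (w i)
  ... | Y′ , e′ , wY = prop i pr Y′ e′ (λ {p} m → weaken (ps m) (≔-mono i w (⊎ₛ-mono-⊑ p wY)) wb)
  weaken (box-R {B = B} Y e d) w nothing with ⊑-ins R (□ B) e (w zero)
  ... | Y′ , e′ , wY = box-R Y′ e′ (weaken d (◂-mono wY (w ∘ suc)) ⊑ᵇ-refl)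
  weaken (box-N {B = B} Y n e d) w nothing with ⊑-ins R (□ B) e (w zero)
  ... | Y′ , e′ , wY = box-N Y′ n e′ (weaken d (◂-mono ⊑-refl (◂-mono wY (w ∘ suc))) nothing)
  weaken (box-L {A = A} Y e d₁ d₂) w (just (wt , wu)) with ⊑-ins L (□ A) e (w zero)
  ... | Y′ , e′ , wY = box-L Y′ e′
        (weaken d₁ (◂-mono (⊎ₛ-mono-⊑ (single L A) wt) (◂-mono wY (w ∘ suc))) nothing)
        (weaken d₂ (◂-mono (⊎ₛ-mono-⊑ (single R A) wu) (◂-mono wY (w ∘ suc))) nothing)
  weaken (box-M m d) w (just (wt , wu)) = box-M m (weaken d w (just (wt , ⊎ₛ-mono-⊑ (single L ⊥̇) wu)))
  weaken (box-C {A = A} Y c e d₁ d₂) w (just (wt , wu)) with ⊑-ins L (□ A) e (w zero)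
  ... | Y′ , e′ , wY = box-C Y′ c e′
        (weaken d₁ (◂-mono wY (w ∘ suc)) (just (⊎ₛ-mono-⊑ (single L A) wt , wu)))
        (weaken d₂ (◂-mono (⊎ₛ-mono-⊑ (single R A) wu) (◂-mono wY (w ∘ suc))) nothing)

  IDer-resp : ∀ {k f g b} → IDer 𝒜 k f b → f ≈ᶜ g → IDer 𝒜 k g b
  IDer-resp d p = weaken d (≈ᶜ⇒⊑ᶜ p) ⊑ᵇ-refl

  IDer-resp-≗ : ∀ {k f g b} → IDer 𝒜 k f b → f ≗ g → IDer 𝒜 k g b
  IDer-resp-≗ d p = IDer-resp d (≗⇒≈ᶜ p)

  mutual
    invert : ∀ {k f b} → IDer 𝒜 k f b → ∀ j {s φ ps} → PropRule s φ ps → ∀ X → f j ≈ₛ ins s φ X →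
             ∀ {p} → p ∈ ps → IDer 𝒜 k (f [ j ]≔ p ⊎ₛ X) b
    invert {f = f} (ax i a) j {s} pr X e {p} m =
      ax i (≔-elim Axiom f j _ i
              (λ { refl → Axiom-mono (Axiom-remove s (PropRule-compound pr) e a) (⊑-⊎ₛ p) }) (λ _ → a))
    invert (prop i pr′ Y e′ ps′) j pr X e m = invert-prop i pr′ Y e′ ps′ j pr X e m
    invert (box-R {B = B} Y e′ d) zero {s} {φ} pr X e {p} m with ins-cases s φ X R (□ B) Y e e′
    ... | inj₁ (_ , refl , _) = ⊥-elim (PropRule-□ pr)
    ... | inj₂ (Z , Y≈ , X≈) = box-R (p ⊎ₛ Z) (⊎ₛ-ins p R (□ B) X≈)
          (IDer-resp-≗ (invert d zero pr Z Y≈ m) ◂-≔-zero)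
    invert (box-R Y e′ d) (suc j) pr X e m = box-R Y e′ (IDer-resp-≗ (invert d (suc j) pr X e m) ◂-≔-suc)
    invert (box-N {B = B} Y n e′ d) zero {s} {φ} pr X e {p} m with ins-cases s φ X R (□ B) Y e e′
    ... | inj₁ (_ , refl , _) = ⊥-elim (PropRule-□ pr)
    ... | inj₂ (Z , Y≈ , X≈) = box-N (p ⊎ₛ Z) n (⊎ₛ-ins p R (□ B) X≈)
          (IDer-resp-≗ (invert d (suc zero) pr Z Y≈ m) ◂◂-≔-one)
    invert (box-N Y n e′ d) (suc j) pr X e m = box-N Y n e′ (IDer-resp-≗ (invert d (suc (suc j)) pr X e m) ◂◂-≔-suc²)
    invert (box-L {A = A} Y e′ d₁ d₂) zero {s} {φ} pr X e {p} m with ins-cases s φ X L (□ A) Y e e′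
    ... | inj₁ (_ , refl , _) = ⊥-elim (PropRule-□ pr)
    ... | inj₂ (Z , Y≈ , X≈) = box-L (p ⊎ₛ Z) (⊎ₛ-ins p L (□ A) X≈)
          (IDer-resp-≗ (invert d₁ (suc zero) pr Z Y≈ m) ◂◂-≔-one)
          (IDer-resp-≗ (invert d₂ (suc zero) pr Z Y≈ m) ◂◂-≔-one)
    invert (box-L Y e′ d₁ d₂) (suc j) pr X e m = box-L Y e′
          (IDer-resp-≗ (invert d₁ (suc (suc j)) pr X e m) ◂◂-≔-suc²)
          (IDer-resp-≗ (invert d₂ (suc (suc j)) pr X e m) ◂◂-≔-suc²)
    invert (box-M n d) j pr X e m = box-M n (invert d j pr X e m)
    invert (box-C {A = A} Y c e′ d₁ d₂) zero {s} {φ} pr X e {p} m with ins-cases s φ X L (□ A) Y e e′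
    ... | inj₁ (_ , refl , _) = ⊥-elim (PropRule-□ pr)
    ... | inj₂ (Z , Y≈ , X≈) = box-C (p ⊎ₛ Z) c (⊎ₛ-ins p L (□ A) X≈)
          (IDer-resp-≗ (invert d₁ zero pr Z Y≈ m) ◂-≔-zero)
          (IDer-resp-≗ (invert d₂ (suc zero) pr Z Y≈ m) ◂◂-≔-one)
    invert (box-C Y c e′ d₁ d₂) (suc j) pr X e m = box-C Y c e′
          (IDer-resp-≗ (invert d₁ (suc j) pr X e m) ◂-≔-suc)
          (IDer-resp-≗ (invert d₂ (suc (suc j)) pr X e m) ◂◂-≔-suc²)

    invert-prop : ∀ {k f b} i {s′ φ′ ps′} → PropRule s′ φ′ ps′ → ∀ Y → f i ≈ₛ ins s′ φ′ Y →
                  (∀ {p} → p ∈ ps′ → IDer 𝒜 k (f [ i ]≔ p ⊎ₛ Y) b) →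
                  ∀ j {s φ ps} → PropRule s φ ps → ∀ X → f j ≈ₛ ins s φ X →
                  ∀ {p} → p ∈ ps → IDer 𝒜 k (f [ j ]≔ p ⊎ₛ X) b
    invert-prop {f = f} i {s′} {φ′} pr′ Y e′ ps′ j {s} {φ} pr X e {p} m with i ≟ j
    ... | no i≢j = prop i pr′ Y (≈ₛ-trans (≔-minimal f j _ i i≢j) e′)
          (λ m′ → IDer-resp (invert (ps′ m′) j pr X (≈ₛ-trans (≔-minimal f i _ j (i≢j ∘ sym)) e) m)
                            (≔-comm f _ _ (i≢j ∘ sym)))
    ... | yes refl with ins-cases s φ X s′ φ′ Y e e′
    ...   | inj₁ (refl , refl , X≈Y) =
            IDer-resp (ps′ (subst (p ∈_) (PropRule-unique pr pr′) m)) (≔-cong f i (⊎ₛ-congʳ p (≈ₛ-sym X≈Y)))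
    ...   | inj₂ (Z , Y≈ , X≈) = prop i pr′ (p ⊎ₛ Z) (≈ₛ-trans (≔-updates f i _) (⊎ₛ-ins p s′ φ′ X≈))
            (λ {p′} m′ → IDer-resp
               (invert (ps′ m′) i pr (p′ ⊎ₛ Z) (≈ₛ-trans (≔-updates f i _) (⊎ₛ-ins p′ s φ Y≈)) m)
                                   (≔²-cong² f i _ _ (⊎ₛ-swap p p′ Z)))

  remove-inert : ∀ {k f b} → IDer 𝒜 k f b → ∀ j s A X → Inert j s b → f j ≈ₛ ins s (□ A) X →
                 IDer 𝒜 k (f [ j ]≔ X) b
  remove-inert {f = f} (ax i a) j s A X _ e =
    ax i (≔-elim Axiom f j X i (λ { refl → Axiom-remove s □c e a }) (λ _ → a))
  remove-inert {f = f} (prop i {s′} {φ′} pr′ Y e′ ps′) j s A X ι e with i ≟ j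
  ... | no i≢j = prop i pr′ Y (≈ₛ-trans (≔-minimal f j X i i≢j) e′)
        (λ m′ → IDer-resp (remove-inert (ps′ m′) j s A X ι (≈ₛ-trans (≔-minimal f i _ j (i≢j ∘ sym)) e))
                          (≔-comm f _ _ (i≢j ∘ sym)))
  ... | yes refl with ins-cases s (□ A) X s′ φ′ Y e e′
  ...   | inj₁ (_ , refl , _) = ⊥-elim (PropRule-□ pr′)
  ...   | inj₂ (Z , Y≈ , X≈) = prop i pr′ Z (≈ₛ-trans (≔-updates f i X) X≈)
          (λ {p′} m′ → IDer-resp
             (remove-inert (ps′ m′) i s A (p′ ⊎ₛ Z) ι (≈ₛ-trans (≔-updates f i _) (⊎ₛ-ins p′ s (□ A) Y≈)))
                                 (≔²-cong² f i _ _ ≈ₛ-refl))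
  remove-inert (box-R Y e′ d) (suc j) s A X _ e =
    box-R Y e′ (IDer-resp-≗ (remove-inert d (suc j) s A X earlier e) ◂-≔-suc)
  remove-inert (box-N Y n e′ d) (suc j) s A X _ e =
    box-N Y n e′ (IDer-resp-≗ (remove-inert d (suc (suc j)) s A X earlier e) ◂◂-≔-suc²)
  remove-inert (box-L {A = A′} Y e′ d₁ d₂) zero R A X blocked e with ins-cases R (□ A) X L (□ A′) Y e e′
  ... | inj₁ (() , _)
  ... | inj₂ (Z , Y≈ , X≈) = box-L Z X≈
        (IDer-resp-≗ (remove-inert d₁ (suc zero) R A Z earlier Y≈) ◂◂-≔-one)
        (IDer-resp-≗ (remove-inert d₂ (suc zero) R A Z earlier Y≈) ◂◂-≔-one)
  remove-inert (box-L Y e′ d₁ d₂) (suc j) s A X _ e = box-L Y e′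
        (IDer-resp-≗ (remove-inert d₁ (suc (suc j)) s A X earlier e) ◂◂-≔-suc²)
        (IDer-resp-≗ (remove-inert d₂ (suc (suc j)) s A X earlier e) ◂◂-≔-suc²)
  remove-inert (box-M n d) j s A X earlier e = box-M n (remove-inert d j s A X earlier e)
  remove-inert (box-M n d) j s A X blocked e = box-M n (remove-inert d j s A X blocked e)
  remove-inert (box-C {A = A′} Y c e′ d₁ d₂) zero R A X blocked e with ins-cases R (□ A) X L (□ A′) Y e e′
  ... | inj₁ (() , _)
  ... | inj₂ (Z , Y≈ , X≈) = box-C Z c X≈
        (IDer-resp-≗ (remove-inert d₁ zero R A Z blocked Y≈) ◂-≔-zero)
        (IDer-resp-≗ (remove-inert d₂ (suc zero) R A Z earlier Y≈) ◂◂-≔-one)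
  remove-inert (box-C Y c e′ d₁ d₂) (suc j) s A X _ e = box-C Y c e′
        (IDer-resp-≗ (remove-inert d₁ (suc j) s A X earlier e) ◂-≔-suc)
        (IDer-resp-≗ (remove-inert d₂ (suc (suc j)) s A X earlier e) ◂◂-≔-suc²)

  -- Contraction

  mutual
    contract : ∀ {k f b} → IDer 𝒜 k f b → ∀ j s A X → f j ≈ₛ ins s A (ins s A X) →
               IDer 𝒜 k (f [ j ]≔ ins s A X) b
    contract {f = f} (ax i a) j s A X e = ax i (≔-elim Axiom f j _ i (λ { refl → Axiom-contract s e a }) (λ _ → a))
    contract (prop i pr′ Y e′ ps′) j s A X e = contract-prop i pr′ Y e′ ps′ j s A X e
    contract (box-R {B = B} Y e′ d) zero s A X e with ins²-cases s A X R (□ B) Y e e′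
    ... | inj₁ (refl , refl , Y≈) = box-R X ≈ₛ-refl (IDer-resp-≗ (remove-inert d zero R B X blocked Y≈) ◂-≔-zero)
    ... | inj₂ (Z , Y≈ , X≈) = box-R (ins s A Z) (⊎ₛ-ins (single s A) R (□ B) X≈)
          (IDer-resp-≗ (contract d zero s A Z Y≈) ◂-≔-zero)
    contract (box-R Y e′ d) (suc j) s A X e = box-R Y e′ (IDer-resp-≗ (contract d (suc j) s A X e) ◂-≔-suc)
    contract (box-N {B = B} Y n e′ d) zero s A X e with ins²-cases s A X R (□ B) Y e e′
    ... | inj₁ (refl , refl , Y≈) = box-N X n ≈ₛ-refl
          (IDer-resp-≗ (remove-inert d (suc zero) R B X earlier Y≈) ◂◂-≔-one)
    ... | inj₂ (Z , Y≈ , X≈) = box-N (ins s A Z) n (⊎ₛ-ins (single s A) R (□ B) X≈)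
          (IDer-resp-≗ (contract d (suc zero) s A Z Y≈) ◂◂-≔-one)
    contract (box-N Y n e′ d) (suc j) s A X e =
      box-N Y n e′ (IDer-resp-≗ (contract d (suc (suc j)) s A X e) ◂◂-≔-suc²)
    contract (box-L {A = A′} Y e′ d₁ d₂) zero s A X e with ins²-cases s A X L (□ A′) Y e e′
    ... | inj₁ (refl , refl , Y≈) = box-L X ≈ₛ-refl
          (IDer-resp-≗ (remove-inert d₁ (suc zero) L A′ X earlier Y≈) ◂◂-≔-one)
          (IDer-resp-≗ (remove-inert d₂ (suc zero) L A′ X earlier Y≈) ◂◂-≔-one)
    ... | inj₂ (Z , Y≈ , X≈) = box-L (ins s A Z) (⊎ₛ-ins (single s A) L (□ A′) X≈)
          (IDer-resp-≗ (contract d₁ (suc zero) s A Z Y≈) ◂◂-≔-one)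
          (IDer-resp-≗ (contract d₂ (suc zero) s A Z Y≈) ◂◂-≔-one)
    contract (box-L Y e′ d₁ d₂) (suc j) s A X e = box-L Y e′
          (IDer-resp-≗ (contract d₁ (suc (suc j)) s A X e) ◂◂-≔-suc²)
          (IDer-resp-≗ (contract d₂ (suc (suc j)) s A X e) ◂◂-≔-suc²)
    contract (box-M n d) j s A X e = box-M n (contract d j s A X e)
    contract (box-C {A = A′} Y c e′ d₁ d₂) zero s A X e with ins²-cases s A X L (□ A′) Y e e′
    ... | inj₁ (refl , refl , Y≈) =
          IDer-resp (absorb-C A′ c d₁ ≈ₛ-refl Y≈
                       (IDer-resp-≗ (remove-inert d₂ (suc zero) L A′ X earlier Y≈) ◂◂-≔-one))
                    (≈ᶜ-trans (◂-cong Y≈ ≈ᶜ-refl) (≗⇒≈ᶜ ≔-zero))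
    ... | inj₂ (Z , Y≈ , X≈) = box-C (ins s A Z) c (⊎ₛ-ins (single s A) L (□ A′) X≈)
          (IDer-resp-≗ (contract d₁ zero s A Z Y≈) ◂-≔-zero)
          (IDer-resp-≗ (contract d₂ (suc zero) s A Z Y≈) ◂◂-≔-one)
    contract (box-C Y c e′ d₁ d₂) (suc j) s A X e = box-C Y c e′
          (IDer-resp-≗ (contract d₁ (suc j) s A X e) ◂-≔-suc)
          (IDer-resp-≗ (contract d₂ (suc (suc j)) s A X e) ◂◂-≔-suc²)

    contract-prop : ∀ {k f b} i {s′ φ′ ps} → PropRule s′ φ′ ps → ∀ Y → f i ≈ₛ ins s′ φ′ Y →
                    (∀ {p} → p ∈ ps → IDer 𝒜 k (f [ i ]≔ p ⊎ₛ Y) b) →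
                    ∀ j s A X → f j ≈ₛ ins s A (ins s A X) → IDer 𝒜 k (f [ j ]≔ ins s A X) b
    contract-prop {f = f} i {s′} {φ′} pr′ Y e′ ps′ j s A X e with i ≟ j
    ... | no i≢j = prop i pr′ Y (≈ₛ-trans (≔-minimal f j _ i i≢j) e′)
          (λ m′ → IDer-resp (contract (ps′ m′) j s A X (≈ₛ-trans (≔-minimal f i _ j (i≢j ∘ sym)) e))
                            (≔-comm f _ _ (i≢j ∘ sym)))
    ... | yes refl with ins²-cases s A X s′ φ′ Y e e′
    ...   | inj₁ (refl , refl , Y≈) = prop i pr′ X (≔-updates f i _)
          (λ {p} m → IDer-resp
             (contract-premiss s A pr′ m i X
                (invert (ps′ m) i pr′ (p ⊎ₛ X) (≈ₛ-trans (≔-updates f i _) (⊎ₛ-ins p s A Y≈)) m)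
                (≔-updates _ i _))
             (≈ᶜ-trans (≔²-cong _ i _ ≈ₛ-refl) (≔²-cong² f i _ _ ≈ₛ-refl)))
    ...   | inj₂ (Z , Y≈ , X≈) =
            prop i pr′ (ins s A Z) (≈ₛ-trans (≔-updates f i _) (⊎ₛ-ins (single s A) s′ φ′ X≈))
          (λ {p} m → IDer-resp (contract (ps′ m) i s A (p ⊎ₛ Z) (≈ₛ-trans (≔-updates f i _) (⊎ₛ-ins² p s A Y≈)))
                               (≔²-cong² f i _ _ (⊎ₛ-swap (single s A) p Z)))

    contract-left : ∀ {k f t u} → IDer 𝒜 k f (just (t , u)) → ∀ s A X → t ≈ₛ ins s A (ins s A X) →
                    IDer 𝒜 k f (just (ins s A X , u))
    contract-left (ax i a) s A X e = ax i a
    contract-left (prop i pr Y e′ ps) s A X e = prop i pr Y e′ (λ m → contract-left (ps m) s A X e)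
    contract-left (box-L {A = A′} Y e′ d₁ d₂) s A X e = box-L Y e′
          (IDer-resp (IDer-resp-≗ (contract d₁ zero s A (ins L A′ X) (⊎ₛ-ins² (single L A′) s A e)) ◂-≔-zero)
                     (◂-cong (⊎ₛ-swap (single s A) (single L A′) X) ≈ᶜ-refl))
          d₂
    contract-left (box-M n d) s A X e = box-M n (contract-left d s A X e)
    contract-left (box-C {A = A′} Y c e′ d₁ d₂) s A X e = box-C Y c e′
          (weaken (contract-left d₁ s A (ins L A′ X) (⊎ₛ-ins² (single L A′) s A e)) ⊑ᶜ-refl
                  (just (≈⇒⊑ (⊎ₛ-swap (single s A) (single L A′) X) , ⊑-refl)))
          d₂

    contract-right : ∀ {k f t u} → IDer 𝒜 k f (just (t , u)) → ∀ s A X → u ≈ₛ ins s A (ins s A X) →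
                     IDer 𝒜 k f (just (t , ins s A X))
    contract-right (ax i a) s A X e = ax i a
    contract-right (prop i pr Y e′ ps) s A X e = prop i pr Y e′ (λ m → contract-right (ps m) s A X e)
    contract-right (box-L {A = A′} Y e′ d₁ d₂) s A X e = box-L Y e′ d₁
          (IDer-resp (IDer-resp-≗ (contract d₂ zero s A (ins R A′ X) (⊎ₛ-ins² (single R A′) s A e)) ◂-≔-zero)
                     (◂-cong (⊎ₛ-swap (single s A) (single R A′) X) ≈ᶜ-refl))
    contract-right (box-M n d) s A X e = box-M n
          (weaken (contract-right d s A (ins L ⊥̇ X) (⊎ₛ-ins² (single L ⊥̇) s A e)) ⊑ᶜ-refl
                  (just (⊑-refl , ≈⇒⊑ (⊎ₛ-swap (single s A) (single L ⊥̇) X))))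
    contract-right (box-C {A = A′} Y c e′ d₁ d₂) s A X e = box-C Y c e′ (contract-right d₁ s A X e)
          (IDer-resp (IDer-resp-≗ (contract d₂ zero s A (ins R A′ X) (⊎ₛ-ins² (single R A′) s A e)) ◂-≔-zero)
                     (◂-cong (⊎ₛ-swap (single s A) (single R A′) X) ≈ᶜ-refl))

    -- Terminates since the formulas of p are proper subformulas of φ.
    contract-premiss : ∀ s φ {ps} → PropRule s φ ps → ∀ {p} → p ∈ ps → ∀ {k f b} j X → IDer 𝒜 k f b →
                       f j ≈ₛ p ⊎ₛ p ⊎ₛ X → IDer 𝒜 k (f [ j ]≔ p ⊎ₛ X) b
    contract-premiss L (¬̇ B) ¬l (here refl) j X d e = contract d j R B X e
    contract-premiss R (¬̇ B) ¬r (here refl) j X d e = contract d j L B X e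
    contract-premiss L (B ∧̇ C) ∧l (here refl) {f = f} j X d e =
      IDer-resp (contract (contract d j L B (ins L C (ins L C X)) (≈ₛ-trans e (↭-prep B (↭-swap C B ↭-refl) , ↭-refl)))
                          j L C (ins L B X)
                          (≈ₛ-trans (≔-updates f j _) (↭-trans (↭-swap B C ↭-refl) (↭-prep C (↭-swap B C ↭-refl)) , ↭-refl)))
                (≔²-cong f j _ (↭-swap C B ↭-refl , ↭-refl))
    contract-premiss R (B ∧̇ C) ∧r (here refl) j X d e = contract d j R B X e
    contract-premiss R (B ∧̇ C) ∧r (there (here refl)) j X d e = contract d j R C X e
    contract-premiss L (B ∨̇ C) ∨l (here refl) j X d e = contract d j L B X e
    contract-premiss L (B ∨̇ C) ∨l (there (here refl)) j X d e = contract d j L C X e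
    contract-premiss R (B ∨̇ C) ∨r (here refl) {f = f} j X d e =
      IDer-resp (contract (contract d j R B (ins R C (ins R C X)) (≈ₛ-trans e (↭-refl , ↭-prep B (↭-swap C B ↭-refl))))
                          j R C (ins R B X)
                          (≈ₛ-trans (≔-updates f j _) (↭-refl , ↭-trans (↭-swap B C ↭-refl) (↭-prep C (↭-swap B C ↭-refl)))))
                (≔²-cong f j _ (↭-refl , ↭-swap C B ↭-refl))
    contract-premiss L (B ⊃ C) ⊃l (here refl) j X d e = contract d j R B X e
    contract-premiss L (B ⊃ C) ⊃l (there (here refl)) j X d e = contract d j L C X e
    contract-premiss R (B ⊃ C) ⊃r (here refl) {f = f} j X d e =
      IDer-resp (contract (contract d j L B (ins R C (ins R C X)) e) j R C (ins L B X) (≔-updates f j _))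
                (≔²-cong f j _ ≈ₛ-refl)

    -- With □A still in the last component, a further C-inference on □A discharges
    -- an extra A from the left sequent of the e-block.
    absorb-C : ∀ A {k g t u T Z} → C 𝒜 ≡ true → IDer 𝒜 k g (just (t , u)) → t ≈ₛ ins L A T →
               g zero ≈ₛ ins L (□ A) Z → IDer 𝒜 (suc k) (ins R A u ◂ Z ◂ tail g) nothing →
               IDer 𝒜 k g (just (T , u))
    absorb-C A c (ax i a) et eg E = ax i a
    absorb-C A {Z = Z} c (prop zero {s′} {φ′} pr′ Y e′ ps′) et eg E with ins-cases L (□ A) Z s′ φ′ Y eg e′
    ... | inj₁ (_ , refl , _) = ⊥-elim (PropRule-□ pr′)
    ... | inj₂ (Z₀ , Y≈ , Z≈) = prop zero pr′ Y e′
          (λ {p} m → absorb-C A c (ps′ m) et (⊎ₛ-ins p L (□ A) Y≈)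
                        (IDer-resp-≗ (invert E (suc zero) pr′ Z₀ Z≈ m) ◂◂-≔-one))
    absorb-C A c (prop (suc i) pr′ Y e′ ps′) et eg E = prop (suc i) pr′ Y e′
          (λ m → absorb-C A c (ps′ m) et eg (IDer-resp-≗ (invert E (suc (suc i)) pr′ Y e′ m) ◂◂-≔-suc²))
    absorb-C A {T = T} {Z} c (box-L {A = A′} Y e′ d₁ d₂) et eg E with ins-cases L (□ A) Z L (□ A′) Y eg e′
    ... | inj₁ (refl , refl , _) = box-L Y e′
          (IDer-resp-≗ (contract d₁ zero L A T (⊎ₛ-congʳ (single L A) et)) ◂-≔-zero) d₂
    ... | inj₂ (Z₀ , Y≈ , Z≈) = box-C Z c eg
          (box-L Z₀ Z≈
             (IDer-resp (IDer-resp-≗ (remove-inert d₁ (suc zero) L A Z₀ earlier Y≈) ◂◂-≔-one)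
                        (◂-cong (⊎ₛ-congʳ (single L A′) et) ≈ᶜ-refl))
             (IDer-resp-≗ (remove-inert d₂ (suc zero) L A Z₀ earlier Y≈) ◂◂-≔-one))
          E
    absorb-C A c (box-M n d) et eg E = box-M n (absorb-C A c d et eg (weaken E (◂-mono (⊑-⊎ₛ (single L ⊥̇)) ⊑ᶜ-refl) nothing))
    absorb-C A {T = T} {Z} c (box-C {A = A′} Y c′ e′ d₁ d₂) et eg E with ins-cases L (□ A) Z L (□ A′) Y eg e′
    ... | inj₁ (refl , refl , _) = box-C Y c′ e′ (contract-left d₁ L A T (⊎ₛ-congʳ (single L A) et)) d₂
    ... | inj₂ (Z₀ , Y≈ , Z≈) = box-C Y c′ e′
          (absorb-C A c d₁ (⊎ₛ-ins (single L A′) L A et) Y≈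
             (IDer-resp-≗ (remove-inert E (suc zero) L A′ Z₀ earlier Z≈) ◂◂-≔-one))
          d₂

-- Translation between structures and component vectors

depth : Str → ℕ → ℕ
depth (leaf _) m = m
depth (eblk _ _ _) m = m
depth (_ / X) m = depth X (suc m)

-- The components of G ⊳ X, where the accumulator holds G in reverse order.
comps : ∀ X {m} → Comps m → Comps (suc (depth X m))
comps (leaf s) acc = s ◂ acc
comps (eblk s _ _) acc = s ◂ acc
comps (s / X) acc = comps X (s ◂ acc)

block : Str → Block
block (leaf _) = nothing
block (eblk _ t u) = just (t , u)
block (_ / X) = block X

IDerAt : Axioms → Str → ∀ {m} → Comps m → Set
IDerAt 𝒜 X {m} acc = IDer 𝒜 (depth X m) (comps X acc) (block X)

comps-cong : ∀ X {m} {acc acc′ : Comps m} → acc ≈ᶜ acc′ → comps X acc ≈ᶜ comps X acc′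
comps-cong (leaf s) p = ◂-cong ≈ₛ-refl p
comps-cong (eblk s t u) p = ◂-cong ≈ₛ-refl p
comps-cong (s / X) p = comps-cong X (◂-cong ≈ₛ-refl p)

toPrefix : ∀ k → Comps k → List Seq
toPrefix zero g = []
toPrefix (suc k) g = toPrefix k (tail g) ++ g zero ∷ []

tip : Seq → Block → Str
tip s nothing = leaf s
tip s (just (t , u)) = eblk s t u

toStr : ∀ k → Comps (suc k) → Block → Str
toStr k f b = toPrefix k (tail f) ⊳ tip (f zero) b

⊳-++ : ∀ G H X → ((G ++ H) ⊳ X) ≡ (G ⊳ (H ⊳ X))
⊳-++ [] H X = refl
⊳-++ (r ∷ G) H X = cong (r /_) (⊳-++ G H X)

toStr-comps : ∀ X {m} (acc : Comps m) → toStr (depth X m) (comps X acc) (block X) ≡ (toPrefix m acc ⊳ X)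
toStr-comps (leaf s) acc = refl
toStr-comps (eblk s t u) acc = refl
toStr-comps (s / X) {m} acc = trans (toStr-comps X (s ◂ acc)) (⊳-++ (toPrefix m acc) (s ∷ []) X)

toPrefix-cong : ∀ k {g h : Comps k} → g ≗ h → toPrefix k g ≡ toPrefix k h
toPrefix-cong zero p = refl
toPrefix-cong (suc k) p = cong₂ _++_ (toPrefix-cong k (p ∘ suc)) (cong (_∷ []) (p zero))

toPrefix-≔ : ∀ k (g : Comps k) i → ∃ λ G → ∃ λ H → ∀ p → toPrefix k (g [ i ]≔ p) ≡ G ++ p ∷ H
toPrefix-≔ (suc k) g zero = toPrefix k (tail g) , [] , λ p → refl
toPrefix-≔ (suc k) g (suc i) with toPrefix-≔ k (tail g) i
... | G , H , eq = G , H ++ g zero ∷ [] , λ p → trans (cong (_++ g zero ∷ []) (eq p)) (++-assoc G (p ∷ H) (g zero ∷ []))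

prefixCtx : List Seq → PCtx → PCtx
prefixCtx [] S = S
prefixCtx (r ∷ G) S = consP r (prefixCtx G S)

pplug-prefixCtx : ∀ G S c → pplug (prefixCtx G S) c ≡ (G ⊳ pplug S c)
pplug-prefixCtx [] S c = refl
pplug-prefixCtx (r ∷ G) S c = cong (r /_) (pplug-prefixCtx G S c)

tipCtx : Block → PCtx
tipCtx nothing = hole
tipCtx (just (t , u)) = holeE t u

pplug-tipCtx : ∀ b c → pplug (tipCtx b) c ≡ tip c b
pplug-tipCtx nothing c = refl
pplug-tipCtx (just _) c = refl

toStr-≔ : ∀ k f b i → ∃ λ S → ∀ p → toStr k (f [ i ]≔ p) b ≡ pplug S p
toStr-≔ k f b zero = prefixCtx (toPrefix k (tail f)) (tipCtx b) ,
  λ p → trans (cong (toPrefix k (tail f) ⊳_) (sym (pplug-tipCtx b p))) (sym (pplug-prefixCtx _ (tipCtx b) p))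
toStr-≔ k f b (suc i) with toPrefix-≔ k (tail f) i
... | G , H , eq = prefixCtx G (holeS (H ⊳ tip (f zero) b)) ,
  λ p → trans (cong (_⊳ tip (f zero) b) (eq p))
       (trans (⊳-++ G (p ∷ H) (tip (f zero) b)) (sym (pplug-prefixCtx G (holeS (H ⊳ tip (f zero) b)) p)))

toStr-≔-self : ∀ k f b i → toStr k (f [ i ]≔ f i) b ≡ toStr k f b
toStr-≔-self k f b i = cong₂ (λ G s → G ⊳ tip s b) (toPrefix-cong k (self ∘ suc)) (self zero)
  where
  self : (f [ i ]≔ f i) ≗ f
  self = updateAt-id-local i f refl

≈-refl : ∀ X → X ≈ X
≈-refl (leaf s) = leaf≈ ↭-refl ↭-refl
≈-refl (eblk s t u) = eblk≈ ↭-refl ↭-refl ↭-refl ↭-refl ↭-refl ↭-refl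
≈-refl (s / X) = /≈ ↭-refl ↭-refl (≈-refl X)

⊳-cong : ∀ G {X Y} → X ≈ Y → G ⊳ X ≈ G ⊳ Y
⊳-cong [] p = p
⊳-cong (r ∷ G) p = /≈ ↭-refl ↭-refl (⊳-cong G p)

pplug-cong : ∀ S {c c′} → c ≈ₛ c′ → pplug S c ≈ pplug S c′
pplug-cong hole (p , q) = leaf≈ p q
pplug-cong (holeE t u) (p , q) = eblk≈ p q ↭-refl ↭-refl ↭-refl ↭-refl
pplug-cong (holeS X) (p , q) = /≈ p q (≈-refl X)
pplug-cong (consP r S) e = /≈ ↭-refl ↭-refl (pplug-cong S e)

module _ {𝒜 : Axioms} where

  IDerAt-resp : ∀ X {m} {acc acc′ : Comps m} → acc ≈ᶜ acc′ → IDerAt 𝒜 X acc → IDerAt 𝒜 X acc′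
  IDerAt-resp X p d = IDer-resp d (comps-cong X p)

  IDerAt-perm : ∀ {X Y m} {acc : Comps m} → X ≈ Y → IDerAt 𝒜 X acc → IDerAt 𝒜 Y acc
  IDerAt-perm (leaf≈ P Q) d = IDer-resp d (◂-cong (P , Q) ≈ᶜ-refl)
  IDerAt-perm (eblk≈ P Q P₁ Q₁ P₂ Q₂) d =
    weaken d (◂-mono (≈⇒⊑ (P , Q)) ⊑ᶜ-refl) (just (≈⇒⊑ (P₁ , Q₁) , ≈⇒⊑ (P₂ , Q₂)))
  IDerAt-perm {X = _ / X} (/≈ P Q r) d = IDerAt-perm r (IDerAt-resp X (◂-cong (P , Q) ≈ᶜ-refl) d)

  Step : List Seq → Seq → Set
  Step ps c = ∀ {k f b} i → (∀ {p} → p ∈ ps → IDer 𝒜 k (f [ i ]≔ p) b) → IDer 𝒜 k (f [ i ]≔ c) b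

  step-in-acc : ∀ X {m} (acc : Comps m) j {ps c} → Step ps c →
                (∀ {p} → p ∈ ps → IDerAt 𝒜 X (acc [ j ]≔ p)) → IDerAt 𝒜 X (acc [ j ]≔ c)
  step-in-acc (leaf s) acc j st prem = IDer-resp-≗ (st (suc j) λ m → IDer-resp-≗ (prem m) (sym ∘ ◂-≔-suc)) ◂-≔-suc
  step-in-acc (eblk s t u) acc j st prem = IDer-resp-≗ (st (suc j) λ m → IDer-resp-≗ (prem m) (sym ∘ ◂-≔-suc)) ◂-≔-suc
  step-in-acc (s / X) acc j st prem =
    IDerAt-resp X (≗⇒≈ᶜ ◂-≔-suc) (step-in-acc X (s ◂ acc) (suc j) st λ m → IDerAt-resp X (≗⇒≈ᶜ (sym ∘ ◂-≔-suc)) (prem m))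

  step-at : ∀ S {m} (acc : Comps m) {ps c} → Step ps c →
            (∀ {p} → p ∈ ps → IDerAt 𝒜 (pplug S p) acc) → IDerAt 𝒜 (pplug S c) acc
  step-at hole acc {c = c} st prem =
    IDer-resp-≗ (st {f = c ◂ acc} zero λ m → IDer-resp-≗ (prem m) (sym ∘ ◂-≔-zero)) ◂-≔-zero
  step-at (holeE t u) acc {c = c} st prem =
    IDer-resp-≗ (st {f = c ◂ acc} zero λ m → IDer-resp-≗ (prem m) (sym ∘ ◂-≔-zero)) ◂-≔-zero
  step-at (holeS X) acc {c = c} st prem =
    IDerAt-resp X (≗⇒≈ᶜ ◂-≔-zero) (step-in-acc X (c ◂ acc) zero st λ m → IDerAt-resp X (≗⇒≈ᶜ (sym ∘ ◂-≔-zero)) (prem m))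
  step-at (consP r S) acc st prem = step-at S (r ◂ acc) st prem

  prefix-map : ∀ {X Y} → (∀ {m} (acc : Comps m) → IDerAt 𝒜 X acc → IDerAt 𝒜 Y acc) →
               ∀ G {m} (acc : Comps m) → IDerAt 𝒜 (G ⊳ X) acc → IDerAt 𝒜 (G ⊳ Y) acc
  prefix-map h [] acc d = h acc d
  prefix-map h (s ∷ G) acc d = prefix-map h G (s ◂ acc) d

  prefix-map₂ : ∀ {X X′ Y} → (∀ {m} (acc : Comps m) → IDerAt 𝒜 X acc → IDerAt 𝒜 X′ acc → IDerAt 𝒜 Y acc) →
                ∀ G {m} (acc : Comps m) → IDerAt 𝒜 (G ⊳ X) acc → IDerAt 𝒜 (G ⊳ X′) acc → IDerAt 𝒜 (G ⊳ Y) acc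
  prefix-map₂ h [] acc d d′ = h acc d d′
  prefix-map₂ h (s ∷ G) acc d d′ = prefix-map₂ h G (s ◂ acc) d d′

  axiom-step : ∀ {c} → Axiom c → Step [] c
  axiom-step a {f = f} i _ = ax i (subst Axiom (sym (updateAt-updates i f)) a)

  prop-step : ∀ {s φ ps} → PropRule s φ ps → ∀ Y → Step (map (_⊎ₛ Y) ps) (ins s φ Y)
  prop-step pr Y {f = f} i prem = prop i pr Y (≔-updates f i _)
    λ {p} m → IDer-resp (prem (∈-map⁺ (_⊎ₛ Y) m)) (λ j → ≈ₛ-sym (≔²-cong f i _ ≈ₛ-refl j))

  contract-step : ∀ s A X → Step (ins s A (ins s A X) ∷ []) (ins s A X)
  contract-step s A X {f = f} i prem =
    IDer-resp (contract (prem (here refl)) i s A X (≔-updates f i _)) (≔²-cong f i _ ≈ₛ-refl)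

  toIDer : ∀ {X} → Der 𝒜 X → ∀ {m} (acc : Comps m) → IDerAt 𝒜 X acc
  toIDer (perm p d) acc = IDerAt-perm p (toIDer d acc)
  toIDer (init S p) acc = step-at S acc (axiom-step (atom p (here refl) (here refl))) λ ()
  toIDer (⊥L S) acc = step-at S acc (axiom-step (bot (here refl))) λ ()
  toIDer (⊤R S) acc = step-at S acc (axiom-step (top (here refl))) λ ()
  toIDer (¬L S {Γ} {Δ} d) acc = step-at S acc (prop-step ¬l (Γ ⇒ Δ)) λ { (here refl) → toIDer d acc }
  toIDer (¬R S {Γ} {Δ} d) acc = step-at S acc (prop-step ¬r (Γ ⇒ Δ)) λ { (here refl) → toIDer d acc }
  toIDer (∧L S {Γ} {Δ} d) acc = step-at S acc (prop-step ∧l (Γ ⇒ Δ)) λ { (here refl) → toIDer d acc }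
  toIDer (∧R S {Γ} {Δ} d₁ d₂) acc =
    step-at S acc (prop-step ∧r (Γ ⇒ Δ)) λ { (here refl) → toIDer d₁ acc ; (there (here refl)) → toIDer d₂ acc }
  toIDer (∨L S {Γ} {Δ} d₁ d₂) acc =
    step-at S acc (prop-step ∨l (Γ ⇒ Δ)) λ { (here refl) → toIDer d₁ acc ; (there (here refl)) → toIDer d₂ acc }
  toIDer (∨R S {Γ} {Δ} d) acc = step-at S acc (prop-step ∨r (Γ ⇒ Δ)) λ { (here refl) → toIDer d acc }
  toIDer (⊃L S {Γ} {Δ} d₁ d₂) acc =
    step-at S acc (prop-step ⊃l (Γ ⇒ Δ)) λ { (here refl) → toIDer d₁ acc ; (there (here refl)) → toIDer d₂ acc }
  toIDer (⊃R S {Γ} {Δ} d) acc = step-at S acc (prop-step ⊃r (Γ ⇒ Δ)) λ { (here refl) → toIDer d acc }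
  toIDer (□eR G {Γ} {Δ} d) acc = prefix-map (λ _ d′ → box-R (Γ ⇒ Δ) ≈ₛ-refl d′) G acc (toIDer d acc)
  toIDer (□eL G {Γ} {Δ} d₁ d₂) acc =
    prefix-map₂ (λ _ d₁′ d₂′ → box-L (Γ ⇒ Δ) ≈ₛ-refl d₁′ d₂′) G acc (toIDer d₁ acc) (toIDer d₂ acc)
  toIDer (Nrule G {Γ} {Δ} n d) acc = prefix-map (λ _ d′ → box-N (Γ ⇒ Δ) n ≈ₛ-refl d′) G acc (toIDer d acc)
  toIDer (Mrule G m d) acc = prefix-map (λ _ d′ → box-M m d′) G acc (toIDer d acc)
  toIDer (Crule G {Γ} {Δ} c d₁ d₂) acc =
    prefix-map₂ (λ _ d₁′ d₂′ → box-C (Γ ⇒ Δ) c ≈ₛ-refl d₁′ d₂′) G acc (toIDer d₁ acc) (toIDer d₂ acc)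

  Axiom-Der : ∀ {s} → Axiom s → ∀ S → Der 𝒜 (pplug S s)
  Axiom-Der (atom p a b) S with ∈-∃++ a | ∈-∃++ b
  ... | Γ₁ , Γ₂ , refl | Δ₁ , Δ₂ , refl = perm (pplug-cong S (↭-sym (shift _ Γ₁ Γ₂) , ↭-sym (shift _ Δ₁ Δ₂))) (init S p)
  Axiom-Der (bot a) S with ∈-∃++ a
  ... | Γ₁ , Γ₂ , refl = perm (pplug-cong S (↭-sym (shift _ Γ₁ Γ₂) , ↭-refl)) (⊥L S)
  Axiom-Der (top b) S with ∈-∃++ b
  ... | Δ₁ , Δ₂ , refl = perm (pplug-cong S (↭-refl , ↭-sym (shift _ Δ₁ Δ₂))) (⊤R S)

  PropRule-Der : ∀ {s φ ps} → PropRule s φ ps → ∀ S Y →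
                 (∀ {p} → p ∈ ps → Der 𝒜 (pplug S (p ⊎ₛ Y))) → Der 𝒜 (pplug S (ins s φ Y))
  PropRule-Der ¬l S Y h = ¬L S (h (here refl))
  PropRule-Der ¬r S Y h = ¬R S (h (here refl))
  PropRule-Der ∧l S Y h = ∧L S (h (here refl))
  PropRule-Der ∧r S Y h = ∧R S (h (here refl)) (h (there (here refl)))
  PropRule-Der ∨l S Y h = ∨L S (h (here refl)) (h (there (here refl)))
  PropRule-Der ∨r S Y h = ∨R S (h (here refl))
  PropRule-Der ⊃l S Y h = ⊃L S (h (here refl)) (h (there (here refl)))
  PropRule-Der ⊃r S Y h = ⊃R S (h (here refl))

  fromIDer : ∀ {k f b} → IDer 𝒜 k f b → Der 𝒜 (toStr k f b)
  fromIDer {k} {f} {b} (ax i a) with toStr-≔ k f b i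
  ... | S , eq = subst (Der 𝒜) (trans (sym (eq (f i))) (toStr-≔-self k f b i)) (Axiom-Der a S)
  fromIDer {k} {f} {b} (prop i pr Y e ps) with toStr-≔ k f b i
  ... | S , eq = subst (Der 𝒜) (trans (sym (eq (f i))) (toStr-≔-self k f b i))
        (perm (pplug-cong S (≈ₛ-sym e)) (PropRule-Der pr S Y λ m → subst (Der 𝒜) (eq _) (fromIDer (ps m))))
  fromIDer {k} {f} (box-R Y e d) =
    perm (⊳-cong (toPrefix k (tail f)) (leaf≈ (↭-sym (proj₁ e)) (↭-sym (proj₂ e)))) (□eR _ (fromIDer d))
  fromIDer {k} {f} (box-N Y n e d) =
    perm (⊳-cong (toPrefix k (tail f)) (leaf≈ (↭-sym (proj₁ e)) (↭-sym (proj₂ e))))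
         (Nrule _ n (subst (Der 𝒜) (⊳-++ (toPrefix k (tail f)) _ _) (fromIDer d)))
  fromIDer {k} {f} (box-L Y e d₁ d₂) =
    perm (⊳-cong (toPrefix k (tail f)) (eblk≈ (↭-sym (proj₁ e)) (↭-sym (proj₂ e)) ↭-refl ↭-refl ↭-refl ↭-refl))
         (□eL _ (subst (Der 𝒜) (⊳-++ (toPrefix k (tail f)) _ _) (fromIDer d₁))
                (subst (Der 𝒜) (⊳-++ (toPrefix k (tail f)) _ _) (fromIDer d₂)))
  fromIDer (box-M m d) = Mrule _ m (fromIDer d)
  fromIDer {k} {f} (box-C Y c e d₁ d₂) =
    perm (⊳-cong (toPrefix k (tail f)) (eblk≈ (↭-sym (proj₁ e)) (↭-sym (proj₂ e)) ↭-refl ↭-refl ↭-refl ↭-refl))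
         (Crule _ c (fromIDer d₁) (subst (Der 𝒜) (⊳-++ (toPrefix k (tail f)) _ _) (fromIDer d₂)))

  fromIDerAt : ∀ X → IDerAt 𝒜 X {0} (λ ()) → Der 𝒜 X
  fromIDerAt X d = subst (Der 𝒜) (toStr-comps X (λ ())) (fromIDer d)

  contract-in-context : ∀ (S : Ctx) s A X → Der 𝒜 (plug S (ins s A (ins s A X))) → Der 𝒜 (plug S (ins s A X))
  contract-in-context (outer P) s A X d =
    fromIDerAt _ (step-at P _ (contract-step s A X) λ { (here refl) → toIDer d (λ ()) })
  contract-in-context (inL G r u) s A X d =
    fromIDerAt _ (prefix-map (λ _ d′ → contract-left d′ s A X ≈ₛ-refl) G _ (toIDer d (λ ())))
  contract-in-context (inR G r t) s A X d =
    fromIDerAt _ (prefix-map (λ _ d′ → contract-right d′ s A X ≈ₛ-refl) G _ (toIDer d (λ ())))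

mainTheorem11 : (𝒜 : Axioms) (S : Ctx) (Γ Δ : List Fm) (A : Fm) →
    (Der 𝒜 (plug S (A ∷ A ∷ Γ ⇒ Δ)) → Der 𝒜 (plug S (A ∷ Γ ⇒ Δ)))
    × (Der 𝒜 (plug S (Γ ⇒ A ∷ A ∷ Δ)) → Der 𝒜 (plug S (Γ ⇒ A ∷ Δ)))
mainTheorem11 𝒜 S Γ Δ A = contract-in-context S L A (Γ ⇒ Δ) , contract-in-context S R A (Γ ⇒ Δ)
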